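{- Let $H$ be a $3$-connected graph, $e=uv$ an edge of $H$ and $w$ a vertex of $H$ such that $\{u,v,w\}$ is a vertex-cut of $H$. Then the following are equivalent: (a) $H$ has no pair of vertex-disjoint cycles one of which contains $e$; (b) each connected component $K$ of $H-\{u,v,w\}$ is a tree having a vertex $x_K$ with $N_H(w)\cap V(K)=\{x_K\}$.
   Context: Graphs are finite, without loops or parallel edges. $N_H(w)$ is the set of neighbors of $w$ in $H$. -}

module Defs where

open import Data.Nat using (ℕ; _<_; _≤_)
open import Data.Bool using (Bool; true; false; T)
open import Data.Fin using (Fin)
open import Data.Fin.Subset using (Subset; _∈_; _∉_; ∣_∣)
open import Data.List using (List; []; _∷_; length)
open import Data.List.Relation.Unary.All using (All)
open import Data.List.Relation.Unary.Unique.Propositional using (Unique)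
import Data.List.Membership.Propositional as LM
open import Data.Product using (Σ; _×_; _,_; ∃)
open import Data.Sum using (_⊎_)
open import Relation.Nullary using (¬_)
open import Relation.Binary.PropositionalEquality using (_≡_; _≢_)

record Graph (n : ℕ) : Set where
  field
    adj   : Fin n → Fin n → Bool
    sym   : ∀ x y → adj x y ≡ adj y x
    loopless : ∀ x → adj x x ≡ false

  E : Fin n → Fin n → Set
  E x y = T (adj x y)

open Graph public

module _ {n : ℕ} (G : Graph n) where

  -- walks all of whose vertices satisfy P (i.e. walks in the induced subgraph G[P])
  data WalkIn (P : Fin n → Set) : Fin n → Fin n → Set where
    here : ∀ {x} → P x → WalkIn P x x
    step : ∀ {x y z} → P x → E G x y → WalkIn P y z → WalkIn P x z

  Connected : (Fin n → Set) → Set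
  Connected P = ∀ x y → P x → P y → WalkIn P x y

  KConnected : ℕ → Set
  KConnected k = k < n × (∀ (S : Subset n) → ∣ S ∣ < k → Connected (λ x → x ∉ S))

-- consecutive pairs of a cyclic sequence x₀ x₁ … x_{m-1}: (x₀,x₁),…,(x_{m-1},x₀)
cycEdgesFrom : {A : Set} → A → List A → List (A × A)
cycEdgesFrom x₀ [] = []
cycEdgesFrom x₀ (y ∷ []) = (y , x₀) ∷ []
cycEdgesFrom x₀ (y ∷ z ∷ r) = (y , z) ∷ cycEdgesFrom x₀ (z ∷ r)

cycEdges : {A : Set} → List A → List (A × A)
cycEdges [] = []
cycEdges (x ∷ xs) = cycEdgesFrom x (x ∷ xs)

module _ {n : ℕ} (G : Graph n) where

  IsCycle : List (Fin n) → Set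
  IsCycle cs = 3 ≤ length cs × Unique cs × All (λ p → E G (Data.Product.proj₁ p) (Data.Product.proj₂ p)) (cycEdges cs)

  CycleContainsEdge : List (Fin n) → Fin n → Fin n → Set
  CycleContainsEdge cs u v = (u , v) LM.∈ cycEdges cs ⊎ (v , u) LM.∈ cycEdges cs

  IsTree : Subset n → Set
  IsTree K = Connected G (_∈ K) × (∀ cs → IsCycle cs → ¬ All (_∈ K) cs)

  IsComponent : (Fin n → Set) → Subset n → Set
  IsComponent P K =
    (∀ x → x ∈ K → P x) × (∃ λ x → x ∈ K) × Connected G (_∈ K) ×
    (∀ x y → x ∈ K → P y → E G x y → y ∈ K)

Outside3 : {n : ℕ} → Fin n → Fin n → Fin n → Fin n → Set
Outside3 u v w x = x ≢ u × x ≢ v × x ≢ w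

VertexDisjoint : {n : ℕ} → List (Fin n) → List (Fin n) → Set
VertexDisjoint c₁ c₂ = ∀ x → x LM.∈ c₁ → ¬ (x LM.∈ c₂)

module Submission where

-- (a ⇒ b) Let K be a component of H − {u,v,w} and z a vertex of H − {u,v,w} outside K. Since
-- H − {v,w} and H − {u,w} are connected, z reaches K in them, necessarily through u and through v
-- respectively; joining the two approaches gives a cycle through uv avoiding K ∪ {w}. So by (a),
-- H[K ∪ {w}] has no cycle: K is acyclic, and w has at most one neighbour in K, and at least one
-- because H − {u,v} is connected.
-- (b ⇒ a) A cycle disjoint from a cycle through uv misses u and v. If it also misses w it lies in a
-- single component, which is a tree; otherwise the two neighbours of w on it are joined by a path
-- outside {u,v,w}, so they are distinct neighbours of w in a single component.

open import Defs
open import Data.Nat using (ℕ; zero; suc; _+_; _∸_; _<_; _≤_; z≤n; s≤s)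
open import Data.Nat.Properties using (+-suc; +-identityʳ; +-monoʳ-≤; m∸n+n≡m; ≤-trans; n≤1+n; ≰⇒>)
import Data.Nat as ℕ
open import Data.Bool using (T; true; false)
open import Data.Fin using (Fin; _≟_)
import Data.Fin as F
open import Data.Fin.Properties using (any?; pigeonhole)
open import Data.Fin.Subset using (Subset; _∈_; _∉_; ∣_∣; ⁅_⁆; _∪_)
open import Data.Fin.Subset.Properties using (x∈⁅x⁆; x∈⁅y⁆⇒x≡y; x∈p∪q⁻; x∈p∪q⁺; ∣⁅x⁆∣≡1; _∈?_)
open import Data.List using (List; []; _∷_; _++_; length; lookup)
open import Data.List.Properties using (∷-injectiveʳ; ++-identityʳ; length-++-sucʳ)
open import Data.List.Relation.Unary.All as All using (All; []; _∷_)
open import Data.List.Relation.Unary.All.Properties using (¬Any⇒All¬; ++⁺; ++⁻ʳ)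
open import Data.List.Relation.Unary.AllPairs using ([]; _∷_)
import Data.List.Relation.Unary.AllPairs.Properties as AllPairs
open import Data.List.Relation.Unary.Any using (here; there)
import Data.List.Relation.Unary.Any as Any
open import Data.List.Relation.Unary.Unique.Propositional using (Unique)
import Data.List.Membership.Propositional as List
open import Data.List.Membership.Propositional.Properties using (∈-∃++; ∈-lookup)
open import Data.List.Relation.Binary.Permutation.Propositional using (↭⇒↭ₛ)
open import Data.List.Relation.Binary.Permutation.Propositional.Properties using (++-comm; ∈-resp-↭; ↭-length)
import Data.List.Relation.Binary.Permutation.Setoid.Properties as Permutationₛ
open import Data.Product using (Σ; _×_; _,_; ∃; proj₁; proj₂)
open import Data.Sum using (_⊎_; inj₁; inj₂)
open import Data.Empty using (⊥; ⊥-elim)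
open import Data.Vec as Vec using (tabulate)
open import Data.Vec.Properties using (lookup∘tabulate; lookup⇒[]=; []=⇒lookup)
open import Relation.Nullary using (¬_; yes; no; ¬?; does)
open import Relation.Nullary.Decidable using (_×-dec_; _⊎-dec_; dec-true)
open import Relation.Nullary.Decidable.Core using (T?)
open import Relation.Unary using (Decidable)
open import Relation.Binary.PropositionalEquality
  using (_≡_; _≢_; refl; trans; cong₂; subst; setoid; ≢-sym)
import Relation.Binary.PropositionalEquality as ≡

module _ {A : Set} where

  Unique-++⁻ʳ : (xs : List A) {ys : List A} → Unique (xs ++ ys) → Unique ys
  Unique-++⁻ʳ []       u       = u
  Unique-++⁻ʳ (x ∷ xs) (_ ∷ u) = Unique-++⁻ʳ xs u

  Unique-++-comm : (xs : List A) {ys : List A} → Unique (xs ++ ys) → Unique (ys ++ xs)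
  Unique-++-comm xs {ys} = Permutationₛ.Unique-resp-↭ (setoid A) (↭⇒↭ₛ (++-comm xs ys))

  Unique⇒lookup-injective : {xs : List A} → Unique xs →
    ∀ i j → i F.< j → lookup xs i ≢ lookup xs j
  Unique⇒lookup-injective (x∉ ∷ _) F.zero    (F.suc j) _         = All.lookup x∉ (∈-lookup j)
  Unique⇒lookup-injective (_ ∷ u)  (F.suc i) (F.suc j) (s≤s i<j) = Unique⇒lookup-injective u i j i<j

Unique⇒length≤ : {n : ℕ} {xs : List (Fin n)} → Unique xs → length xs ≤ n
Unique⇒length≤ {n} {xs} u with length xs ℕ.≤? n
... | yes ≤n = ≤n
... | no ≰n with pigeonhole (≰⇒> ≰n) (lookup xs)
...   | i , j , i<j , eq = ⊥-elim (Unique⇒lookup-injective u i j i<j eq)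

∣p∪q∣≤∣p∣+∣q∣ : {n : ℕ} (p q : Subset n) → ∣ p ∪ q ∣ ≤ ∣ p ∣ + ∣ q ∣
∣p∪q∣≤∣p∣+∣q∣ Vec.[] Vec.[] = z≤n
∣p∪q∣≤∣p∣+∣q∣ (true  Vec.∷ p) (true  Vec.∷ q) =
  s≤s (≤-trans (∣p∪q∣≤∣p∣+∣q∣ p q) (+-monoʳ-≤ ∣ p ∣ (n≤1+n ∣ q ∣)))
∣p∪q∣≤∣p∣+∣q∣ (true  Vec.∷ p) (false Vec.∷ q) = s≤s (∣p∪q∣≤∣p∣+∣q∣ p q)
∣p∪q∣≤∣p∣+∣q∣ (false Vec.∷ p) (true  Vec.∷ q) =
  subst (suc ∣ p ∪ q ∣ ≤_) (≡.sym (+-suc ∣ p ∣ ∣ q ∣)) (s≤s (∣p∪q∣≤∣p∣+∣q∣ p q))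
∣p∪q∣≤∣p∣+∣q∣ (false Vec.∷ p) (false Vec.∷ q) = ∣p∪q∣≤∣p∣+∣q∣ p q

module _ {n : ℕ} {Q : Fin n → Set} (Q? : Decidable Q) where

  ∈-tabulate⁺ : ∀ {x} → Q x → x ∈ tabulate (λ y → does (Q? y))
  ∈-tabulate⁺ {x} q = lookup⇒[]= x _ (trans (lookup∘tabulate _ x) (dec-true (Q? x) q))

  ∈-tabulate⁻ : ∀ {x} → x ∈ tabulate (λ y → does (Q? y)) → Q x
  ∈-tabulate⁻ {x} x∈ with Q? x | trans (≡.sym (lookup∘tabulate _ x)) ([]=⇒lookup x∈)
  ... | yes q | _  = q
  ... | no _  | ()

-- Walks, chains and paths

module _ {n : ℕ} (G : Graph n) where

  E-sym : ∀ {x y} → E G x y → E G y x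
  E-sym {x} {y} = subst T (Graph.sym G x y)

  E⇒≢ : ∀ {x y} → E G x y → x ≢ y
  E⇒≢ {x} e refl = subst T (loopless G x) e

  module _ {P : Fin n → Set} where

    walk-head : ∀ {x y} → WalkIn G P x y → P x
    walk-head (here p)     = p
    walk-head (step p _ _) = p

    walk-++ : ∀ {x y z} → WalkIn G P x y → WalkIn G P y z → WalkIn G P x z
    walk-++ (here _)     w′ = w′
    walk-++ (step p e w) w′ = step p e (walk-++ w w′)

    walk-reverse : ∀ {x y} → WalkIn G P x y → WalkIn G P y x
    walk-reverse (here p)     = here p
    walk-reverse (step p e w) = walk-++ (walk-reverse w) (step (walk-head w) (E-sym e) (here p))

  walk-map : ∀ {P Q : Fin n → Set} {x y} → (∀ {z} → P z → Q z) → WalkIn G P x y → WalkIn G Q x y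
  walk-map f (here p)     = here (f p)
  walk-map f (step p e w) = step (f p) e (walk-map f w)

  Connected-resp : ∀ {P Q : Fin n → Set} → (∀ {x} → P x → Q x) → (∀ {x} → Q x → P x) →
    Connected G Q → Connected G P
  Connected-resp P⊆Q Q⊆P conn x y px py = walk-map Q⊆P (conn x y (P⊆Q px) (P⊆Q py))

  connected-avoiding₂ : KConnected G 3 → ∀ a b → Connected G (λ x → x ≢ a × x ≢ b)
  connected-avoiding₂ (_ , conn) a b = Connected-resp avoid⁺ avoid⁻ (conn S ∣S∣<3)
    where
    S : Subset n
    S = ⁅ a ⁆ ∪ ⁅ b ⁆

    ∣S∣<3 : ∣ S ∣ < 3
    ∣S∣<3 = s≤s (subst (∣ S ∣ ≤_) (cong₂ _+_ (∣⁅x⁆∣≡1 a) (∣⁅x⁆∣≡1 b)) (∣p∪q∣≤∣p∣+∣q∣ ⁅ a ⁆ ⁅ b ⁆))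

    avoid⁺ : ∀ {x} → x ≢ a × x ≢ b → x ∉ S
    avoid⁺ (x≢a , x≢b) x∈S with x∈p∪q⁻ ⁅ a ⁆ ⁅ b ⁆ x∈S
    ... | inj₁ x∈a = x≢a (x∈⁅y⁆⇒x≡y a x∈a)
    ... | inj₂ x∈b = x≢b (x∈⁅y⁆⇒x≡y b x∈b)

    avoid⁻ : ∀ {x} → x ∉ S → x ≢ a × x ≢ b
    avoid⁻ x∉S = (λ { refl → x∉S (x∈p∪q⁺ (inj₁ (x∈⁅x⁆ a))) })
               , (λ { refl → x∉S (x∈p∪q⁺ (inj₂ (x∈⁅x⁆ b))) })

  infixr 5 _▸_

  data Chain : Fin n → List (Fin n) → Fin n → Set where
    stop : ∀ {x} → Chain x (x ∷ []) x
    _▸_  : ∀ {x y z l} → E G x y → Chain y (y ∷ l) z → Chain x (x ∷ y ∷ l) z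

  chain-++ : ∀ {a y b z l m} → Chain a (a ∷ l) y → E G y b → Chain b (b ∷ m) z →
    Chain a ((a ∷ l) ++ (b ∷ m)) z
  chain-++ stop      e c′ = e ▸ c′
  chain-++ (e₀ ▸ c) e c′ = e₀ ▸ chain-++ c e c′

  chain-split : ∀ {a b m y} (l : List (Fin n)) → Chain a (a ∷ l ++ b ∷ m) y →
    (∃ λ z → Chain a (a ∷ l) z × E G z b) × Chain b (b ∷ m) y
  chain-split []      (e ▸ c) = (_ , stop , e) , c
  chain-split (_ ∷ l) (e ▸ c) with chain-split l c
  ... | (z , c′ , e′) , c″ = (z , e ▸ c′ , e′) , c″

  chain-suffix : ∀ {y l z x m} (k : List (Fin n)) → Chain y l z → l ≡ k ++ x ∷ m → Chain x (x ∷ m) z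
  chain-suffix []          stop    refl = stop
  chain-suffix (_ ∷ [])    stop    ()
  chain-suffix (_ ∷ _ ∷ _) stop    ()
  chain-suffix []          (e ▸ c) refl = e ▸ c
  chain-suffix (_ ∷ k)     (e ▸ c) eq   = chain-suffix k c (∷-injectiveʳ eq)

  chain-last : ∀ {a l z} → Chain a l z → z List.∈ l
  chain-last stop    = here refl
  chain-last (e ▸ c) = there (chain-last c)

  record Path (P : Fin n → Set) (x y : Fin n) : Set where
    constructor path
    field
      rest   : List (Fin n)
      chain  : Chain x (x ∷ rest) y
      unique : Unique (x ∷ rest)
      inside : All P (x ∷ rest)

  walk⇒path : ∀ {P x y} → WalkIn G P x y → Path P x y
  walk⇒path (here p) = path [] stop ([] ∷ []) (p ∷ [])
  walk⇒path {x = x} (step p e w) with walk⇒path w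
  ... | path l c u ps with Any.any? (x ≟_) (_ ∷ l)
  ... | no x∉ = path (_ ∷ l) (e ▸ c) (¬Any⇒All¬ _ x∉ ∷ u) (p ∷ ps)
  ... | yes x∈ with ∈-∃++ x∈
  ...   | k , m , eq =
    path m (chain-suffix k c eq) (Unique-++⁻ʳ k (subst Unique eq u)) (++⁻ʳ k (subst (All _) eq ps))

-- Cycles

  IsEdge : Fin n × Fin n → Set
  IsEdge p = E G (proj₁ p) (proj₂ p)

  closedChain⇒edges : ∀ {x₀ a l y} → Chain a (a ∷ l) y → E G y x₀ →
    All IsEdge (cycEdgesFrom x₀ (a ∷ l))
  closedChain⇒edges stop    e′ = e′ ∷ []
  closedChain⇒edges (e ▸ c) e′ = e ∷ closedChain⇒edges c e′

  edges⇒closedChain : ∀ {x₀ a l} → All IsEdge (cycEdgesFrom x₀ (a ∷ l)) →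
    ∃ λ y → Chain a (a ∷ l) y × E G y x₀
  edges⇒closedChain {l = []}    (e ∷ [])  = _ , stop , e
  edges⇒closedChain {l = _ ∷ l} (e ∷ es) with edges⇒closedChain {l = l} es
  ... | y , c , e′ = y , e ▸ c , e′

  closedPath⇒cycle : ∀ {x l y} → Chain x (x ∷ l) y → Unique (x ∷ l) → E G y x → 2 ≤ length l →
    IsCycle G (x ∷ l)
  closedPath⇒cycle c u e 2≤ = s≤s 2≤ , u , closedChain⇒edges c e

  cycle-rotate : ∀ {w} (l m : List (Fin n)) → IsCycle G (l ++ w ∷ m) → IsCycle G (w ∷ m ++ l)
  cycle-rotate {w} l m (3≤ , u , es) =
    subst (3 ≤_) (↭-length (++-comm l (w ∷ m))) 3≤ , Unique-++-comm l u , edges l es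
    where
    edges : ∀ l → All IsEdge (cycEdges (l ++ w ∷ m)) → All IsEdge (cycEdges (w ∷ m ++ l))
    edges [] es = subst (λ k → All IsEdge (cycEdges (w ∷ k))) (≡.sym (++-identityʳ m)) es
    edges (_ ∷ l) es with edges⇒closedChain es
    ... | _ , c , e with chain-split l c
    ...   | (_ , c′ , e′) , c″ = closedChain⇒edges (chain-++ c″ e c′) e′

  cycle-through-edge : ∀ {Q u v a b} → E G v u → (p : Path Q a b) → (∀ {x} → Q x → x ≢ u × x ≢ v) →
    E G u a → E G b v → IsCycle G (u ∷ (a ∷ Path.rest p) ++ v ∷ [])
  cycle-through-edge {v = v} vu (path rest c uniq inside) avoid ua bv =
    closedPath⇒cycle (ua ▸ chain-++ c bv stop)
      (++⁺ (All.map (λ q → ≢-sym (proj₁ (avoid q))) inside) (≢-sym (E⇒≢ vu) ∷ []) ∷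
       AllPairs.++⁺ uniq ([] ∷ []) (All.map (λ q → proj₂ (avoid q) ∷ []) inside))
      vu
      (s≤s (subst (1 ≤_) (≡.sym (length-++-sucʳ rest v [])) (s≤s z≤n)))

  ∈-cycEdgesFrom⁻ : ∀ {x₀ a b} (l : List (Fin n)) → (a , b) List.∈ cycEdgesFrom x₀ l →
    a List.∈ l × (b List.∈ l ⊎ b ≡ x₀)
  ∈-cycEdgesFrom⁻ (_ ∷ [])    (here refl) = here refl , inj₂ refl
  ∈-cycEdgesFrom⁻ (_ ∷ _ ∷ _) (here refl) = here refl , inj₁ (there (here refl))
  ∈-cycEdgesFrom⁻ (_ ∷ z ∷ l) (there ab∈) with ∈-cycEdgesFrom⁻ (z ∷ l) ab∈
  ... | a∈ , inj₁ b∈ = there a∈ , inj₁ (there b∈)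
  ... | a∈ , inj₂ eq = there a∈ , inj₂ eq

  ∈-cycEdges⁻ : ∀ {a b} (l : List (Fin n)) → (a , b) List.∈ cycEdges l → a List.∈ l × b List.∈ l
  ∈-cycEdges⁻ (c ∷ l) ab∈ with ∈-cycEdgesFrom⁻ (c ∷ l) ab∈
  ... | a∈ , inj₁ b∈   = a∈ , b∈
  ... | a∈ , inj₂ refl = a∈ , here refl

  last∈cycEdgesFrom : ∀ {v} (x₀ : Fin n) (l : List (Fin n)) → (v , x₀) List.∈ cycEdgesFrom x₀ (l ++ v ∷ [])
  last∈cycEdgesFrom x₀ []          = here refl
  last∈cycEdgesFrom x₀ (_ ∷ [])    = there (here refl)
  last∈cycEdgesFrom x₀ (_ ∷ b ∷ l) = there (last∈cycEdgesFrom x₀ (b ∷ l))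

  CycleContainsEdge⇒∈ : ∀ {u v} (C : List (Fin n)) → CycleContainsEdge G C u v → u List.∈ C × v List.∈ C
  CycleContainsEdge⇒∈ C (inj₁ uv∈) = ∈-cycEdges⁻ C uv∈
  CycleContainsEdge⇒∈ C (inj₂ vu∈) with ∈-cycEdges⁻ C vu∈
  ... | v∈ , u∈ = u∈ , v∈

-- Components

  component-closed : ∀ {P K x y} → IsComponent G P K → x ∈ K → P y → E G x y → y ∈ K
  component-closed (_ , _ , _ , closed) = closed _ _

  component-connected : ∀ {P K} → IsComponent G P K → Connected G (_∈ K)
  component-connected (_ , _ , connected , _) = connected

  component-chain : ∀ {P K a l y} → IsComponent G P K → Chain a l y → All P l → a ∈ K → All (_∈ K) l
  component-chain comp stop    (_ ∷ [])  a∈K = a∈K ∷ []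
  component-chain comp (e ▸ c) (_ ∷ ps) a∈K =
    a∈K ∷ component-chain comp c ps (component-closed comp a∈K (All.head ps) e)

  module _ {P : Fin n → Set} (P? : Decidable P) {x₀ : Fin n} (p₀ : P x₀) where

    Reach : ℕ → Fin n → Set
    Reach zero    y = y ≡ x₀
    Reach (suc k) y = Reach k y ⊎ (∃ λ z → Reach k z × P y × E G z y)

    reach? : ∀ k → Decidable (Reach k)
    reach? zero    y = y ≟ x₀
    reach? (suc k) y = reach? k y ⊎-dec any? (λ z → reach? k z ×-dec (P? y ×-dec T? (adj G z y)))

    Reach⇒P : ∀ {k y} → Reach k y → P y
    Reach⇒P {zero}  refl                  = p₀
    Reach⇒P {suc k} (inj₁ r)              = Reach⇒P r
    Reach⇒P {suc k} (inj₂ (_ , _ , p , _)) = p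

    Reach⇒walk : ∀ {k y} → Reach k y → WalkIn G P x₀ y
    Reach⇒walk {zero}  refl                  = here p₀
    Reach⇒walk {suc k} (inj₁ r)              = Reach⇒walk r
    Reach⇒walk {suc k} (inj₂ (_ , r , p , e)) = walk-++ (Reach⇒walk r) (step (Reach⇒P r) e (here p))

    Reach-mono : ∀ {k m y} → k ≤ m → Reach k y → Reach m y
    Reach-mono {k} {m} k≤m r = subst (λ j → Reach j _) (m∸n+n≡m k≤m) (weaken (m ∸ k) r)
      where
      weaken : ∀ i {j y} → Reach j y → Reach (i + j) y
      weaken zero    r = r
      weaken (suc i) r = inj₁ (weaken i r)

    chain⇒Reach : ∀ {k a l y} → Reach k a → Chain a (a ∷ l) y → All P (a ∷ l) → Reach (k + length l) y
    chain⇒Reach {k} {a} r stop _ = subst (λ j → Reach j a) (≡.sym (+-identityʳ k)) r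
    chain⇒Reach {k} {a} {_ ∷ l} {y} r (e ▸ c) (_ ∷ ps) =
      subst (λ j → Reach j y) (≡.sym (+-suc k (length l))) (chain⇒Reach (inj₂ (a , r , All.head ps , e)) c ps)

    -- a simple path has at most n vertices, so n steps reach everything reachable
    walk⇒Reach : ∀ {y} → WalkIn G P x₀ y → Reach n y
    walk⇒Reach w with walk⇒path w
    ... | path l c u ps = Reach-mono (≤-trans (n≤1+n (length l)) (Unique⇒length≤ u)) (chain⇒Reach refl c ps)

    componentOf : Subset n
    componentOf = tabulate (λ y → does (reach? n y))

    walk⇒∈componentOf : ∀ {y} → WalkIn G P x₀ y → y ∈ componentOf
    walk⇒∈componentOf w = ∈-tabulate⁺ (reach? n) (walk⇒Reach w)

    componentOf⊆P : ∀ {y} → y ∈ componentOf → P y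
    componentOf⊆P y∈ = Reach⇒P (∈-tabulate⁻ (reach? n) y∈)

    ∈componentOf⇒walk : ∀ {y} → y ∈ componentOf → WalkIn G P x₀ y
    ∈componentOf⇒walk y∈ = Reach⇒walk (∈-tabulate⁻ (reach? n) y∈)

    x₀∈componentOf : x₀ ∈ componentOf
    x₀∈componentOf = walk⇒∈componentOf (here p₀)

    componentOf-connected : Connected G (_∈ componentOf)
    componentOf-connected x y x∈ y∈ = lift (walk-++ (walk-reverse (∈componentOf⇒walk x∈)) (∈componentOf⇒walk y∈))
                                           (∈componentOf⇒walk x∈)
      where
      lift : ∀ {a b} → WalkIn G P a b → WalkIn G P x₀ a → WalkIn G (_∈ componentOf) a b
      lift (here _)     wa = here (walk⇒∈componentOf wa)
      lift (step p e w) wa = step (walk⇒∈componentOf wa) e (lift w (walk-++ wa (step p e (here (walk-head w)))))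

    componentOf-isComponent : IsComponent G P componentOf
    componentOf-isComponent =
      (λ _ → componentOf⊆P) ,
      (x₀ , x₀∈componentOf) ,
      componentOf-connected ,
      (λ x y x∈ py e → walk⇒∈componentOf (walk-++ (∈componentOf⇒walk x∈) (step (componentOf⊆P x∈) e (here py))))

  module _ {P : Fin n → Set} {K : Subset n} (comp : IsComponent G P K) where

    component-proper : Decidable P → ¬ Connected G P → ∃ λ z → P z × z ∉ K
    component-proper P? disconnected with any? (λ z → P? z ×-dec ¬? (z ∈? K))
    ... | yes witness = witness
    ... | no none     = ⊥-elim (disconnected (Connected-resp P⊆K (proj₁ comp _) (component-connected comp)))
      where
      P⊆K : ∀ {x} → P x → x ∈ K
      P⊆K {x} px with x ∈? K
      ... | yes x∈K = x∈K
      ... | no  x∉K = ⊥-elim (none (x , px , x∉K))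

    module _ {Q : Fin n → Set} {t : Fin n} (Q⊆P+t : ∀ {x} → Q x → x ≢ t → P x) where

      exit-component-via : ∀ {k z} → WalkIn G Q k z → k ∈ K → z ∉ K → ∃ λ a → a ∈ K × E G a t
      exit-component-via (here _) k∈K k∉K = ⊥-elim (k∉K k∈K)
      exit-component-via {k} (step {y = y} _ e w) k∈K z∉K with y ≟ t
      ... | yes refl = k , k∈K , e
      ... | no  y≢t  = exit-component-via w (component-closed comp k∈K (Q⊆P+t (walk-head w) y≢t) e) z∉K

      enter-component-via : ∀ {z k} → WalkIn G Q z k → P z → z ∉ K → k ∈ K →
        ∃ λ a → E G a t × WalkIn G (λ x → P x × x ∉ K) z a
      enter-component-via (here _) _ z∉K z∈K = ⊥-elim (z∉K z∈K)
      enter-component-via {z} (step {y = y} _ e w) pz z∉K k∈K with y ≟ t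
      ... | yes refl = z , e , here (pz , z∉K)
      ... | no  y≢t
        with enter-component-via w (Q⊆P+t (walk-head w) y≢t) (λ y∈K → z∉K (component-closed comp y∈K pz (E-sym e))) k∈K
      ...   | a , ea , wa = a , ea , step (pz , z∉K) e wa

-- Components of H − {u,v,w}

module _ {n : ℕ} {H : Graph n} (conn₃ : KConnected H 3) {u v w : Fin n} (uv : E H u v)
         (disconnected : ¬ Connected H (Outside3 u v w)) where

  private
    O : Fin n → Set
    O = Outside3 u v w

    O? : Decidable O
    O? x = ¬? (x ≟ u) ×-dec (¬? (x ≟ v) ×-dec ¬? (x ≟ w))

  DisjointCyclesThroughUV : Set
  DisjointCyclesThroughUV = Σ (List (Fin n)) λ C₁ → Σ (List (Fin n)) λ C₂ →
    IsCycle H C₁ × IsCycle H C₂ × VertexDisjoint C₁ C₂ × CycleContainsEdge H C₁ u v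

  TreeAttachedOnce : Subset n → Set
  TreeAttachedOnce K =
    IsTree H K × (Σ (Fin n) λ x → x ∈ K × (∀ y → y ∈ K → (E H w y → y ≡ x) × (y ≡ x → E H w y)))

  w≢u : w ≢ u
  w≢u refl = disconnected (Connected-resp H (λ (x≢u , x≢v , _) → x≢u , x≢v)
                                             (λ (x≢u , x≢v) → x≢u , x≢v , x≢u)
                                             (connected-avoiding₂ H conn₃ u v))

  w≢v : w ≢ v
  w≢v refl = disconnected (Connected-resp H (λ (x≢u , x≢v , _) → x≢u , x≢v)
                                             (λ (x≢u , x≢v) → x≢u , x≢v , x≢v)
                                             (connected-avoiding₂ H conn₃ u v))

  separated⇒disjoint : ∀ {K} C₁ C₂ → All (λ x → x ∉ K × x ≢ w) C₁ → All (λ x → x ≡ w ⊎ x ∈ K) C₂ →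
    VertexDisjoint C₁ C₂
  separated⇒disjoint C₁ C₂ avoid₁ in₂ x x∈C₁ x∈C₂ with All.lookup avoid₁ x∈C₁ | All.lookup in₂ x∈C₂
  ... | _   , x≢w | inj₁ x≡w = x≢w x≡w
  ... | x∉K , _   | inj₂ x∈K = x∉K x∈K

  disjoint-avoids-uv : ∀ {C₁ C₂} → VertexDisjoint C₁ C₂ → CycleContainsEdge H C₁ u v →
    ∀ {x} → x List.∈ C₂ → x ≢ u × x ≢ v
  disjoint-avoids-uv {C₁} disjoint uv∈C₁ x∈C₂ with CycleContainsEdge⇒∈ H C₁ uv∈C₁
  ... | u∈C₁ , v∈C₁ = (λ { refl → disjoint _ u∈C₁ x∈C₂ }) , (λ { refl → disjoint _ v∈C₁ x∈C₂ })

  module _ {K : Subset n} (comp : IsComponent H O K) where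
    private
      K⊆O = proj₁ comp
      k₀ = proj₁ (proj₁ (proj₂ comp))
      k₀∈K = proj₂ (proj₁ (proj₂ comp))
      outsider = component-proper H comp O? disconnected
      z = proj₁ outsider
      Oz = proj₁ (proj₂ outsider)
      z∉K = proj₂ (proj₂ outsider)
      z≢u = proj₁ Oz
      z≢v = proj₁ (proj₂ Oz)
      z≢w = proj₂ (proj₂ Oz)
      k₀≢u = proj₁ (K⊆O k₀ k₀∈K)
      k₀≢v = proj₁ (proj₂ (K⊆O k₀ k₀∈K))
      k₀≢w = proj₂ (proj₂ (K⊆O k₀ k₀∈K))
      u∉K : u ∉ K
      u∉K u∈K = proj₁ (K⊆O u u∈K) refl
      v∉K : v ∉ K
      v∉K v∈K = proj₁ (proj₂ (K⊆O v v∈K)) refl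

    cycle-through-uv-avoiding-K∪w : ∃ λ C → IsCycle H C × CycleContainsEdge H C u v × All (λ x → x ∉ K × x ≢ w) C
    cycle-through-uv-avoiding-K∪w
      with enter-component-via H comp (λ (x≢v , x≢w) x≢u → x≢u , x≢v , x≢w)
             (connected-avoiding₂ H conn₃ v w z k₀ (z≢v , z≢w) (k₀≢v , k₀≢w)) Oz z∉K k₀∈K
         | enter-component-via H comp (λ (x≢u , x≢w) x≢v → x≢u , x≢v , x≢w)
             (connected-avoiding₂ H conn₃ u w z k₀ (z≢u , z≢w) (k₀≢u , k₀≢w)) Oz z∉K k₀∈K
    ... | a , au , za | b , bv , zb =
      let p = walk⇒path H (walk-++ H (walk-reverse H za) zb) in
      _ , cycle-through-edge H (E-sym H uv) p (λ ((x≢u , x≢v , _) , _) → x≢u , x≢v) (E-sym H au) bv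
        , inj₂ (last∈cycEdgesFrom H u (u ∷ a ∷ Path.rest p))
        , (u∉K , ≢-sym w≢u) ∷ ++⁺ (All.map (λ ((_ , _ , x≢w) , x∉K) → x∉K , x≢w) (Path.inside p))
                                  ((v∉K , ≢-sym w≢v) ∷ [])

    neighbour-of-w : ∃ λ x → x ∈ K × E H x w
    neighbour-of-w = exit-component-via H comp (λ (x≢u , x≢v) x≢w → x≢u , x≢v , x≢w)
      (connected-avoiding₂ H conn₃ u v k₀ z (k₀≢u , k₀≢v) (z≢u , z≢v)) k₀∈K z∉K

    two-neighbours⇒cycle : ∀ {x y} → x ∈ K → y ∈ K → E H w x → E H w y → x ≢ y →
      ∃ λ C → IsCycle H C × All (λ c → c ≡ w ⊎ c ∈ K) C
    two-neighbours⇒cycle {x} {y} x∈K y∈K wx wy x≢y with walk⇒path H (component-connected H comp x y x∈K y∈K)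
    ... | path []         stop _    _      = ⊥-elim (x≢y refl)
    ... | path (r ∷ rest) c    uniq inside =
      w ∷ x ∷ r ∷ rest ,
      closedPath⇒cycle H (wx ▸ c) (All.map w∉ inside ∷ uniq) (E-sym H wy) (s≤s (s≤s z≤n)) ,
      inj₁ refl ∷ All.map inj₂ inside
      where
      w∉ : ∀ {c} → c ∈ K → w ≢ c
      w∉ c∈K refl = proj₂ (proj₂ (K⊆O w c∈K)) refl

  no-pair⇒attached-trees : ¬ DisjointCyclesThroughUV → ∀ K → IsComponent H O K → TreeAttachedOnce K
  no-pair⇒attached-trees noPair K comp with cycle-through-uv-avoiding-K∪w comp | neighbour-of-w comp
  ... | C₁ , cyc₁ , uv∈C₁ , avoid₁ | x , x∈K , xw =
    (component-connected H comp , λ C cyc C⊆K → pair-with C cyc (All.map inj₂ C⊆K)) ,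
    x , x∈K , λ y y∈K → unique y y∈K , λ { refl → E-sym H xw }
    where
    pair-with : ∀ C → IsCycle H C → All (λ c → c ≡ w ⊎ c ∈ K) C → ⊥
    pair-with C cyc C⊆K+w = noPair (C₁ , C , cyc₁ , cyc , separated⇒disjoint C₁ C avoid₁ C⊆K+w , uv∈C₁)

    unique : ∀ y → y ∈ K → E H w y → y ≡ x
    unique y y∈K wy with y ≟ x
    ... | yes y≡x = y≡x
    ... | no  y≢x with two-neighbours⇒cycle comp x∈K y∈K (E-sym H xw) wy (≢-sym y≢x)
    ...   | C , cyc , C⊆K+w = ⊥-elim (pair-with C cyc C⊆K+w)

  module _ (trees : ∀ K → IsComponent H O K → TreeAttachedOnce K) where

    no-two-neighbours⇒cycle : ∀ R → IsCycle H (w ∷ R) → All (λ x → x ≢ u × x ≢ v) R → ⊥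
    no-two-neighbours⇒cycle []          (s≤s () , _)
    no-two-neighbours⇒cycle (_ ∷ [])    (s≤s (s≤s ()) , _)
    no-two-neighbours⇒cycle (q ∷ r ∷ R) (_ , (w∉ ∷ q∉ ∷ _) , es) avoid
      with edges⇒closedChain H {x₀ = w} {l = q ∷ r ∷ R} es
    ... | y , wq ▸ qy@(_ ▸ ry) , yw = All.lookup q∉ (chain-last H ry) (trans q≡x (≡.sym y≡x))
      where
      Os : All O (q ∷ r ∷ R)
      Os = All.zipWith (λ ((x≢u , x≢v) , w≢x) → x≢u , x≢v , ≢-sym w≢x) (avoid , w∉)
      comp = componentOf-isComponent H O? (All.head Os)
      attached = proj₂ (proj₂ (proj₂ (trees _ comp)))
      q∈K = x₀∈componentOf H O? (All.head Os)
      q≡x = proj₁ (attached q q∈K) wq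
      y≡x = proj₁ (attached y (All.lookup (component-chain H comp qy Os q∈K) (chain-last H qy))) (E-sym H yw)

    no-cycle-avoiding-w : ∀ C → IsCycle H C → All O C → ⊥
    no-cycle-avoiding-w []      (() , _)
    no-cycle-avoiding-w (c ∷ C) cyc@(_ , _ , es) Os with edges⇒closedChain H {x₀ = c} {l = C} es
    ... | _ , ch , _ = proj₂ (proj₁ (trees _ comp)) (c ∷ C) cyc
                         (component-chain H comp ch Os (x₀∈componentOf H O? (All.head Os)))
      where comp = componentOf-isComponent H O? (All.head Os)

    attached-trees⇒no-pair : ¬ DisjointCyclesThroughUV
    attached-trees⇒no-pair (C₁ , C₂ , _ , cyc₂ , disjoint , uv∈C₁) with Any.any? (w ≟_) C₂
    ... | yes w∈C₂ with ∈-∃++ w∈C₂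
    ...   | l , m , refl = no-two-neighbours⇒cycle (m ++ l) (cycle-rotate H l m cyc₂)
            (All.tabulate λ x∈ → disjoint-avoids-uv disjoint uv∈C₁ (∈-resp-↭ (++-comm (w ∷ m) l) (there x∈)))
    attached-trees⇒no-pair (C₁ , C₂ , _ , cyc₂ , disjoint , uv∈C₁) | no w∉C₂ =
      no-cycle-avoiding-w C₂ cyc₂ (All.tabulate λ x∈ →
        let (x≢u , x≢v) = disjoint-avoids-uv disjoint uv∈C₁ x∈ in x≢u , x≢v , λ { refl → w∉C₂ x∈ })

lemma2p10 : {n : ℕ} (H : Graph n) → KConnected H 3 →
    (u v w : Fin n) → E H u v → ¬ Connected H (Outside3 u v w) →
    ((¬ (Σ (List (Fin n)) λ C₁ → Σ (List (Fin n)) λ C₂ →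
          IsCycle H C₁ × IsCycle H C₂ × VertexDisjoint C₁ C₂ × CycleContainsEdge H C₁ u v))
      → (∀ (K : Subset n) → IsComponent H (Outside3 u v w) K →
          IsTree H K × (Σ (Fin n) λ x → x ∈ K × (∀ y → y ∈ K → (E H w y → y ≡ x) × (y ≡ x → E H w y)))))
    ×
    ((∀ (K : Subset n) → IsComponent H (Outside3 u v w) K →
          IsTree H K × (Σ (Fin n) λ x → x ∈ K × (∀ y → y ∈ K → (E H w y → y ≡ x) × (y ≡ x → E H w y))))
      → ¬ (Σ (List (Fin n)) λ C₁ → Σ (List (Fin n)) λ C₂ →
          IsCycle H C₁ × IsCycle H C₂ × VertexDisjoint C₁ C₂ × CycleContainsEdge H C₁ u v))
lemma2p10 H conn₃ u v w uv disconnected =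
  no-pair⇒attached-trees conn₃ uv disconnected , attached-trees⇒no-pair conn₃ uv disconnected
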